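{- Let $t$ be a positive integer and let $C$ be a perfect $t$-deletion code of length $n$ with $n>t$. Then $$\# C \ge \frac{2^n}{\binom{n-1}{t}}\cdot\frac{\lfloor n^{1/3}\rfloor+1}{\lfloor n^{1/3}\rfloor+1+2t}\cdot\frac{\binom{\lfloor n^{2/3}\rfloor+t-1}{t}}{\binom{\lfloor n^{2/3}\rfloor+\lfloor n^{1/3}\rfloor+3t-1}{t}}\cdot\left(1-\sum_{r<\lfloor n^{1/3}\rfloor-1+\lfloor n^{2/3}\rfloor+t}\frac{\binom{n-1}{r}}{2^{n-1}}-\sum_{r>n-1-\lfloor n^{2/3}\rfloor+t}\frac{\binom{n-1}{r}}{2^{n-1}}\right),$$ where the sums run over integers $r$ and $\binom{n-1}{r}=0$ for $r<0$ or $r>n-1$.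
   Context: Let $\mathbb{B}=\{0,1\}$ and $\mathbb{B}^n$ the set of binary sequences of length $n$ ($\mathbb{B}^0=\{\epsilon\}$). For a binary sequence $\mathbf{x}$, $\mathrm{dS}^t(\mathbf{x})$ denotes the set of sequences obtained from $\mathbf{x}$ by deleting exactly $t$ symbols, and $\mathrm{dS}^t(X)=\bigcup_{\mathbf{x}\in X}\mathrm{dS}^t(\mathbf{x})$. A set $C\subseteq\mathbb{B}^n$ is a $t$-deletion code of length $n$ if $\mathrm{dS}^t(\mathbf{c})\cap\mathrm{dS}^t(\mathbf{d})=\emptyset$ for all distinct $\mathbf{c},\mathbf{d}\in C$; it is perfect if additionally $\mathrm{dS}^t(C)=\mathbb{B}^{n-t}$. $\#X$ is the cardinality of $X$. -}

module Defs where

open import Data.Bool using (Bool; true; false; if_then_else_)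
open import Data.Nat using (ℕ; zero; suc; _+_; _*_; _∸_; _^_; _<ᵇ_; _≤ᵇ_)
open import Data.Nat.Combinatorics using (_C_)
open import Data.Integer using (+_)
open import Data.List using (List; []; _∷_; length)
open import Data.List.Membership.Propositional using (_∈_)
open import Data.List.Relation.Unary.All using (All)
open import Data.Product using (∃; _×_)
open import Data.Empty using (⊥)
open import Relation.Binary.PropositionalEquality using (_≡_; _≢_)
open import Data.Rational using (ℚ; _/_; 0ℚ; 1ℚ; _-_)
  renaming (_*_ to _*ℚ_)

data Del : ℕ → List Bool → List Bool → Set where
  del-nil  : Del 0 [] []
  del-keep : ∀ {t x xs ys} → Del t xs ys → Del t (x ∷ xs) (x ∷ ys)
  del-drop : ∀ {t x xs ys} → Del t xs ys → Del (suc t) (x ∷ xs) ys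

-- C ⊆ 𝔹^n, given as a duplicate-free list of words of length n.
IsBinaryCode : ℕ → List (List Bool) → Set
IsBinaryCode n C = All (λ c → length c ≡ n) C

IsDeletionCode : ℕ → ℕ → List (List Bool) → Set
IsDeletionCode t n C =
  IsBinaryCode n C ×
  (∀ {c d} → c ∈ C → d ∈ C → c ≢ d → ∀ y → Del t c y → Del t d y → ⊥)

IsPerfectDeletionCode : ℕ → ℕ → List (List Bool) → Set
IsPerfectDeletionCode t n C =
  IsDeletionCode t n C ×
  (∀ y → length y ≡ n ∸ t → ∃ λ c → c ∈ C × Del t c y)

cbrtFloor : ℕ → ℕ
cbrtFloor m = go m
  where
  go : ℕ → ℕ
  go zero = zero
  go (suc k) = if (suc k ^ 3) ≤ᵇ m then suc k else go k

-- ⌊n^(1/3)⌋ and ⌊n^(2/3)⌋ = ⌊(n^2)^(1/3)⌋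
floorCbrt : ℕ → ℕ
floorCbrt n = cbrtFloor n

floorCbrtSq : ℕ → ℕ
floorCbrtSq n = cbrtFloor (n ^ 2)

-- a / d as a rational (d = 0 never occurs in the theorem; conventionally 0)
frac : ℕ → ℕ → ℚ
frac a zero = 0ℚ
frac a (suc d) = (+ a) / suc d

sumBelow : ℕ → (ℕ → ℕ) → ℕ
sumBelow zero f = 0
sumBelow (suc m) f = sumBelow m f + f m

-- Σ_{r integer, r < L} C(n-1, r)   (terms with r < 0 or r > n-1 vanish)
lowerTail : ℕ → ℕ → ℕ
lowerTail n L = sumBelow n (λ r → if r <ᵇ L then (n ∸ 1) C r else 0)

upperTail : ℕ → ℕ → ℕ
upperTail n U = sumBelow n (λ r → if U <ᵇ r then (n ∸ 1) C r else 0)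

-- The right-hand side of the bound, with a = ⌊n^{1/3}⌋, b = ⌊n^{2/3}⌋.
-- Natural subtractions here are never truncated when n > t ≥ 1:
-- a ≥ 1, b ≤ n, t ≥ 1.
bound : ℕ → ℕ → ℚ
bound t n =
  frac (2 ^ n) ((n ∸ 1) C t)
  *ℚ frac (a + 1) (a + 1 + 2 * t)
  *ℚ frac ((b + t ∸ 1) C t) ((b + a + 3 * t ∸ 1) C t)
  *ℚ (1ℚ - frac (lowerTail n (a ∸ 1 + b + t)) (2 ^ (n ∸ 1))
         - frac (upperTail n (n ∸ 1 ∸ b + t)) (2 ^ (n ∸ 1)))
  where
  a = floorCbrt n
  b = floorCbrtSq n

module Submission where

-- Let t ≥ 1, n = t + o + 1, m = n - t, and let C be a list of words whose t-deletion
-- balls cover 𝔹^m (the only consequence of perfectness that is used).  Deleting t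
-- symbols destroys at most 2t runs (Del-runs), and a word with r runs has at most
-- C(r + t - 1, t) distinct t-deletions (deletion-count, spreading the deletions over
-- the runs).  So with κ R = C(R + 3t - 1, t) every codeword c has
-- Σ_{y ∈ dS^t(c)} 1/κ(runs y) ≤ 1, and covering gives Σ_{y ∈ 𝔹^m} 1/κ(runs y) ≤ #C.
-- Exactly 2 C(m-1, k) words of length m have k + 1 runs, so the left side is
-- 2 Σ_k C(o, k)/κ(k+1); by trinomial revision and the monotonicity estimate `window`
-- each term with r = t + k ≥ L dominates the constant of the bound times
-- C(n-1, r)/C(n-1, t), and Σ_{r ≥ L} C(n-1, r) is 2^(n-1) minus the lower tail.
-- Denominators are cleared with the integer weights Z/κ(R), Z = Π_R κ(R).

module Combinatorics where

  open import Defs using (Del; del-nil; del-keep; del-drop; sumBelow; lowerTail)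
  open import Data.Bool using (Bool; true; false; if_then_else_; T)
  open import Data.Nat
  open import Data.Nat.Properties
  open import Data.Nat.Combinatorics using (_C_; nCk+nC[k+1]≡[n+1]C[k+1])
  open import Data.Nat.Solver using (module +-*-Solver)
  open import Data.List using (List; []; _∷_; _++_; length; replicate; map)
  open import Data.List.Properties using (length-++; length-map; length-replicate)
  open import Data.List.Membership.Propositional using (_∈_)
  open import Data.List.Membership.Propositional.Properties
    using (∈-++⁺ˡ; ∈-++⁺ʳ; ∈-map⁺; ∈-map⁻; ∈-++⁻; ∈-∃++)
  open import Data.List.Relation.Unary.Any using (here; there)
  open import Data.List.Relation.Unary.All as All using ([])
  open import Data.List.Relation.Unary.Unique.Propositional using (Unique; []; _∷_)
  import Data.List.Relation.Unary.Unique.Propositional.Properties as Unique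
  open import Data.Product using (_,_; _×_; ∃; ∃-syntax)
  open import Data.Sum using (inj₁; inj₂; [_,_])
  open import Data.Empty using (⊥; ⊥-elim)
  open import Data.Unit using (tt)
  open import Function using (_∘_)
  import Data.Bool.Properties as Bool
  open import Relation.Nullary using (Dec; yes; no)
  open import Relation.Nullary.Decidable using (map′; _×-dec_; _⊎-dec_)
  open import Relation.Unary using (Decidable)
  open import Relation.Binary.PropositionalEquality hiding ([_])
  open +-*-Solver

  -- Binomial coefficients by Pascal's rule.  The library's _C_ is defined by a
  -- division; this structurally recursive version is the one the inductions use.
  binom : ℕ → ℕ → ℕ
  binom _       zero    = 1
  binom zero    (suc k) = 0
  binom (suc n) (suc k) = binom n k + binom n (suc k)

  binom≡C : ∀ n k → binom n k ≡ n C k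
  binom≡C zero    zero    = refl
  binom≡C zero    (suc k) = refl
  binom≡C (suc n) zero    = refl
  binom≡C (suc n) (suc k) =
    trans (cong₂ _+_ (binom≡C n k) (binom≡C n (suc k))) (nCk+nC[k+1]≡[n+1]C[k+1] n k)

  binom-zero : ∀ n k → n < k → binom n k ≡ 0
  binom-zero zero    (suc k) _         = refl
  binom-zero (suc n) (suc k) (s≤s n<k) =
    cong₂ _+_ (binom-zero n k n<k) (binom-zero n (suc k) (m<n⇒m<1+n n<k))

  binom-pos : ∀ n k → k ≤ n → 0 < binom n k
  binom-pos n       zero    _         = z<s
  binom-pos (suc n) (suc k) (s≤s k≤n) = ≤-trans (binom-pos n k k≤n) (m≤m+n _ _)

  C-pos : ∀ {n k} → k ≤ n → 0 < n C k
  C-pos {n} {k} k≤n = subst (0 <_) (binom≡C n k) (binom-pos n k k≤n)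

  binom-monoˡ : ∀ k {m n} → m ≤ n → binom m k ≤ binom n k
  binom-monoˡ k {n = zero}  z≤n = ≤-refl
  binom-monoˡ k {n = suc n} m≤1+n with m≤n⇒m<n∨m≡n m≤1+n
  ... | inj₂ refl      = ≤-refl
  ... | inj₁ (s≤s m≤n) = ≤-trans (binom-monoˡ k m≤n) (step n k)
    where
    step : ∀ n k → binom n k ≤ binom (suc n) k
    step n       zero    = ≤-refl
    step zero    (suc k) = z≤n
    step (suc n) (suc k) = m≤n+m (binom (suc n) (suc k)) (binom (suc n) k)

  binom-1 : ∀ n → binom n 1 ≡ n
  binom-1 zero    = refl
  binom-1 (suc n) = cong suc (binom-1 n)

  absorption : ∀ j t → suc t * binom (suc j) (suc t) ≡ suc j * binom j t
  absorption j zero =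
    trans (*-identityˡ _) (trans (binom-1 (suc j)) (sym (*-identityʳ (suc j))))
  absorption zero    (suc t) = *-zeroʳ (suc (suc t))
  absorption (suc j) (suc s) = begin
      suc (suc s) * (X + Y)
    ≡⟨ solve 3 (λ s X Y → (con 2 :+ s) :* (X :+ Y) := X :+ (con 1 :+ s) :* X :+ (con 2 :+ s) :* Y) refl s X Y ⟩
      X + suc s * X + suc (suc s) * Y
    ≡⟨ cong₂ (λ u v → X + u + v) (absorption j s) (absorption j (suc s)) ⟩
      X + suc j * binom j s + suc j * binom j (suc s)
    ≡⟨ solve 3 (λ j P R → (P :+ R) :+ (con 1 :+ j) :* P :+ (con 1 :+ j) :* R := (con 2 :+ j) :* (P :+ R)) refl j (binom j s) (binom j (suc s)) ⟩
      suc (suc j) * X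
    ∎
    where
    open ≡-Reasoning
    X = binom (suc j) (suc s)
    Y = binom (suc j) (suc (suc s))

  trinomial-revision : ∀ T M K → binom (T + M) (T + K) * binom (T + K) T ≡ binom (T + M) T * binom M K
  trinomial-revision zero    M K = trans (*-identityʳ _) (sym (+-identityʳ _))
  -- Multiply by (T+K+1)(T+1) and peel one factor off each coefficient by absorption.
  trinomial-revision (suc T) M K = *-cancelˡ-≡ _ _ (suc (T + K) * suc T) (begin
      suc (T + K) * suc T * (A₁ * A₂)
    ≡⟨ solve 4 (λ p q x y → p :* q :* (x :* y) := (p :* x) :* (q :* y)) refl (suc (T + K)) (suc T) A₁ A₂ ⟩
      (suc (T + K) * A₁) * (suc T * A₂)
    ≡⟨ cong₂ _*_ (absorption (T + M) (T + K)) (absorption (T + K) T) ⟩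
      (suc (T + M) * a₁) * (suc (T + K) * a₂)
    ≡⟨ solve 4 (λ p q x y → (p :* x) :* (q :* y) := p :* q :* (x :* y)) refl (suc (T + M)) (suc (T + K)) a₁ a₂ ⟩
      suc (T + M) * suc (T + K) * (a₁ * a₂)
    ≡⟨ cong (suc (T + M) * suc (T + K) *_) (trinomial-revision T M K) ⟩
      suc (T + M) * suc (T + K) * (a₃ * binom M K)
    ≡⟨ solve 4 (λ p q x y → p :* q :* (x :* y) := q :* (p :* x) :* y) refl (suc (T + M)) (suc (T + K)) a₃ (binom M K) ⟩
      suc (T + K) * (suc (T + M) * a₃) * binom M K
    ≡⟨ cong (λ u → suc (T + K) * u * binom M K) (sym (absorption (T + M) T)) ⟩
      suc (T + K) * (suc T * A₃) * binom M K
    ≡⟨ solve 4 (λ p q x y → p :* (q :* x) :* y := p :* q :* (x :* y)) refl (suc (T + K)) (suc T) A₃ (binom M K) ⟩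
      suc (T + K) * suc T * (A₃ * binom M K)
    ∎)
    where
    open ≡-Reasoning
    A₁ = binom (suc T + M) (suc T + K)
    A₂ = binom (suc T + K) (suc T)
    A₃ = binom (suc T + M) (suc T)
    a₁ = binom (T + M) (T + K)
    a₂ = binom (T + K) T
    a₃ = binom (T + M) T

  falling : ℕ → ℕ → ℕ
  falling j       zero    = 1
  falling zero    (suc t) = 0
  falling (suc j) (suc t) = suc j * falling j t

  binom*!≡falling : ∀ j t → binom j t * t ! ≡ falling j t
  binom*!≡falling j       zero    = refl
  binom*!≡falling zero    (suc t) = refl
  binom*!≡falling (suc j) (suc t) = begin
      binom (suc j) (suc t) * (suc t * t !)
    ≡⟨ solve 3 (λ x y z → x :* (y :* z) := (y :* x) :* z) refl (binom (suc j) (suc t)) (suc t) (t !) ⟩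
      (suc t * binom (suc j) (suc t)) * t !
    ≡⟨ cong (_* t !) (absorption j t) ⟩
      suc j * binom j t * t !
    ≡⟨ *-assoc (suc j) (binom j t) (t !) ⟩
      suc j * (binom j t * t !)
    ≡⟨ cong (suc j *_) (binom*!≡falling j t) ⟩
      suc j * falling j t
    ∎
    where open ≡-Reasoning

  shifted-product-≤ : ∀ i e d → suc i * suc (i + e + d) ≤ suc (i + e) * suc (i + d)
  shifted-product-≤ i e d = begin
      suc i * suc (i + e + d)
    ≡⟨ solve 3 (λ i e d → (con 1 :+ i) :* (con 1 :+ (i :+ e :+ d)) := (con 1 :+ i) :* (con 1 :+ (i :+ d)) :+ (con 1 :+ i) :* e) refl i e d ⟩
      suc i * suc (i + d) + suc i * e
    ≤⟨ +-monoʳ-≤ (suc i * suc (i + d)) (*-monoˡ-≤ e (s≤s (m≤m+n i d))) ⟩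
      suc i * suc (i + d) + suc (i + d) * e
    ≡⟨ solve 3 (λ i e d → (con 1 :+ i) :* (con 1 :+ (i :+ d)) :+ (con 1 :+ (i :+ d)) :* e := (con 1 :+ (i :+ e)) :* (con 1 :+ (i :+ d))) refl i e d ⟩
      suc (i + e) * suc (i + d)
    ∎
    where open ≤-Reasoning

  -- falling (j + d) t / falling j t is nonincreasing in j.
  falling-cross : ∀ t d {j j'} → j ≤ j' → falling j t * falling (j' + d) t ≤ falling j' t * falling (j + d) t
  falling-cross zero    d _ = ≤-refl
  falling-cross (suc t) d {zero} _ = z≤n
  falling-cross (suc t) d {suc i} (s≤s i≤i') with m≤n⇒∃[o]m+o≡n i≤i'
  ... | e , refl = begin
      (suc i * falling i t) * (suc (i + e + d) * falling (i + e + d) t)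
    ≡⟨ solve 4 (λ a b c d → (a :* b) :* (c :* d) := (a :* c) :* (b :* d)) refl (suc i) (falling i t) (suc (i + e + d)) (falling (i + e + d) t) ⟩
      (suc i * suc (i + e + d)) * (falling i t * falling (i + e + d) t)
    ≤⟨ *-mono-≤ (shifted-product-≤ i e d) (falling-cross t d i≤i') ⟩
      (suc (i + e) * suc (i + d)) * (falling (i + e) t * falling (i + d) t)
    ≡⟨ solve 4 (λ a b c d → (a :* c) :* (b :* d) := (a :* b) :* (c :* d)) refl (suc (i + e)) (falling (i + e) t) (suc (i + d)) (falling (i + d) t) ⟩
      (suc (i + e) * falling (i + e) t) * (suc (i + d) * falling (i + d) t)
    ∎
    where open ≤-Reasoning

  -- The same for binomial coefficients: C(j + d, t) / C(j, t) is nonincreasing in j.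
  binom-cross : ∀ t d {j j'} → j ≤ j' → binom j t * binom (j' + d) t ≤ binom j' t * binom (j + d) t
  binom-cross t d {j} {j'} j≤j' = *-cancelʳ-≤ _ _ (t ! * t !) {{m*n≢0 (t !) (t !) {{t !≢0}} {{t !≢0}}}} (begin
      binom j t * binom (j' + d) t * (t ! * t !)
    ≡⟨ solve 3 (λ x y f → x :* y :* (f :* f) := (x :* f) :* (y :* f)) refl (binom j t) (binom (j' + d) t) (t !) ⟩
      (binom j t * t !) * (binom (j' + d) t * t !)
    ≡⟨ cong₂ _*_ (binom*!≡falling j t) (binom*!≡falling (j' + d) t) ⟩
      falling j t * falling (j' + d) t
    ≤⟨ falling-cross t d j≤j' ⟩
      falling j' t * falling (j + d) t
    ≡⟨ sym (cong₂ _*_ (binom*!≡falling j' t) (binom*!≡falling (j + d) t)) ⟩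
      (binom j' t * t !) * (binom (j + d) t * t !)
    ≡⟨ solve 3 (λ x y f → (x :* f) :* (y :* f) := x :* y :* (f :* f)) refl (binom j' t) (binom (j + d) t) (t !) ⟩
      binom j' t * binom (j + d) t * (t ! * t !)
    ∎)
    where open ≤-Reasoning

  window-top : ∀ a b t → b + a + 3 * suc t ∸ 1 ≡ a + b + t + 2 * suc t
  window-top a b t = cong (_∸ 1)
    (solve 3 (λ a b t → b :+ a :+ con 3 :* (con 1 :+ t) := con 1 :+ (a :+ b :+ t :+ con 2 :* (con 1 :+ t))) refl a b t)

  window-denominator-pos : ∀ a b t → 0 < (b + a + 3 * suc t ∸ 1) C suc t
  window-denominator-pos a b t =
    C-pos (subst (suc t ≤_) (sym (window-top a b t)) (≤-trans (m≤m+n (suc t) _) (m≤n+m (2 * suc t) (a + b + t))))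

  -- For r ≥ a - 1 + b + t the ratio C(r+2t, t) / C(r, t) is at most the constant
  -- (a+1+2t) C(b+a+3t-1, t) / ((a+1) C(b+t-1, t)) of the bound; t ≥ 1 is written as suc t.
  window : ∀ a b t r → a ∸ 1 + b + suc t ≤ r →
    (a + 1) * ((b + suc t ∸ 1) C suc t) * ((r + 2 * suc t) C suc t)
      ≤ (a + 1 + 2 * suc t) * ((b + a + 3 * suc t ∸ 1) C suc t) * (r C suc t)
  window a b t r start≤r = begin
      (a + 1) * ((b + t⁺ ∸ 1) C t⁺) * ((r + 2 * t⁺) C t⁺)
    ≡⟨ sym (cong₂ (λ x y → (a + 1) * x * y) (binom≡C (b + t⁺ ∸ 1) t⁺) (binom≡C (r + 2 * t⁺) t⁺)) ⟩
      (a + 1) * binom (b + t⁺ ∸ 1) t⁺ * binom (r + 2 * t⁺) t⁺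
    ≤⟨ *-monoˡ-≤ _ (*-mono-≤ (m≤m+n (a + 1) (2 * t⁺)) (binom-monoˡ t⁺ b+t-1≤j)) ⟩
      (a + 1 + 2 * t⁺) * binom j t⁺ * binom (r + 2 * t⁺) t⁺
    ≡⟨ *-assoc (a + 1 + 2 * t⁺) _ _ ⟩
      (a + 1 + 2 * t⁺) * (binom j t⁺ * binom (r + 2 * t⁺) t⁺)
    ≤⟨ *-monoʳ-≤ (a + 1 + 2 * t⁺) (binom-cross t⁺ (2 * t⁺) j≤r) ⟩
      (a + 1 + 2 * t⁺) * (binom r t⁺ * binom (j + 2 * t⁺) t⁺)
    ≡⟨ solve 3 (λ x y z → x :* (y :* z) := x :* z :* y) refl (a + 1 + 2 * t⁺) (binom r t⁺) (binom (j + 2 * t⁺) t⁺) ⟩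
      (a + 1 + 2 * t⁺) * binom (j + 2 * t⁺) t⁺ * binom r t⁺
    ≡⟨ cong₂ (λ x y → (a + 1 + 2 * t⁺) * x * y) (trans (cong (λ i → binom i t⁺) (sym (window-top a b t))) (binom≡C (b + a + 3 * t⁺ ∸ 1) t⁺)) (binom≡C r t⁺) ⟩
      (a + 1 + 2 * t⁺) * ((b + a + 3 * t⁺ ∸ 1) C t⁺) * (r C t⁺)
    ∎
    where
    open ≤-Reasoning
    t⁺ = suc t
    j = a + b + t
    threshold : ∀ a → a + b + t ≤ a ∸ 1 + b + suc t
    threshold zero    = +-monoʳ-≤ b (n≤1+n t)
    threshold (suc a) = ≤-reflexive (sym (+-suc (a + b) t))
    j≤r : j ≤ r
    j≤r = ≤-trans (threshold a) start≤r
    b+t-1≤j : b + t⁺ ∸ 1 ≤ j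
    b+t-1≤j = ≤-trans (≤-reflexive (cong (_∸ 1) (+-suc b t)))
                (≤-trans (m≤n+m (b + t) a) (≤-reflexive (sym (+-assoc a b t))))

  sumBelow-cong : ∀ N {f g : ℕ → ℕ} → (∀ k → f k ≡ g k) → sumBelow N f ≡ sumBelow N g
  sumBelow-cong zero    f≡g = refl
  sumBelow-cong (suc N) f≡g = cong₂ _+_ (sumBelow-cong N f≡g) (f≡g N)

  sumBelow-mono : ∀ N {f g : ℕ → ℕ} → (∀ k → f k ≤ g k) → sumBelow N f ≤ sumBelow N g
  sumBelow-mono zero    f≤g = z≤n
  sumBelow-mono (suc N) f≤g = +-mono-≤ (sumBelow-mono N f≤g) (f≤g N)

  sumBelow-+ : ∀ N (f g : ℕ → ℕ) → sumBelow N (λ k → f k + g k) ≡ sumBelow N f + sumBelow N g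
  sumBelow-+ zero    f g = refl
  sumBelow-+ (suc N) f g = trans (cong (_+ (f N + g N)) (sumBelow-+ N f g))
    (solve 4 (λ a b c d → a :+ b :+ (c :+ d) := a :+ c :+ (b :+ d)) refl (sumBelow N f) (sumBelow N g) (f N) (g N))

  sumBelow-*ˡ : ∀ N c (f : ℕ → ℕ) → sumBelow N (λ k → c * f k) ≡ c * sumBelow N f
  sumBelow-*ˡ zero    c f = sym (*-zeroʳ c)
  sumBelow-*ˡ (suc N) c f = trans (cong (_+ c * f N) (sumBelow-*ˡ N c f)) (sym (*-distribˡ-+ c (sumBelow N f) (f N)))

  sumBelow-0 : ∀ N → sumBelow N (λ _ → 0) ≡ 0
  sumBelow-0 zero    = refl
  sumBelow-0 (suc N) = trans (+-identityʳ _) (sumBelow-0 N)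

  sumBelow-suc : ∀ N (f : ℕ → ℕ) → sumBelow (suc N) f ≡ f 0 + sumBelow N (λ k → f (suc k))
  sumBelow-suc zero    f = +-comm 0 (f 0)
  sumBelow-suc (suc N) f = trans (cong (_+ f (suc N)) (sumBelow-suc N f)) (+-assoc (f 0) _ (f (suc N)))

  sumBelow-drop : ∀ t m (f : ℕ → ℕ) → (∀ r → r < t → f r ≡ 0) → sumBelow (t + m) f ≡ sumBelow m (λ k → f (t + k))
  sumBelow-drop zero    m f _     = refl
  sumBelow-drop (suc t) m f zeros = begin
      sumBelow (suc (t + m)) f
    ≡⟨ sumBelow-suc (t + m) f ⟩
      f 0 + sumBelow (t + m) (λ r → f (suc r))
    ≡⟨ cong₂ _+_ (zeros 0 z<s) (sumBelow-drop t m (λ r → f (suc r)) (λ r r<t → zeros (suc r) (s<s r<t))) ⟩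
      sumBelow m (λ k → f (suc t + k))
    ∎
    where open ≡-Reasoning

  binomSum : ℕ → ℕ → (ℕ → ℕ) → ℕ
  binomSum N m h = sumBelow N (λ k → binom m k * h k)

  binomSum-pascal : ∀ N m h → binomSum (suc N) (suc m) h ≡ binomSum (suc N) m h + binomSum N m (λ k → h (suc k))
  binomSum-pascal N m h = begin
      binomSum (suc N) (suc m) h
    ≡⟨ sumBelow-suc N (λ k → binom (suc m) k * h k) ⟩
      1 * h 0 + sumBelow N (λ k → (binom m k + binom m (suc k)) * h (suc k))
    ≡⟨ cong (1 * h 0 +_) (trans (sumBelow-cong N (λ k → *-distribʳ-+ (h (suc k)) (binom m k) (binom m (suc k))))
                                 (sumBelow-+ N (λ k → binom m k * h (suc k)) (λ k → binom m (suc k) * h (suc k)))) ⟩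
      1 * h 0 + (binomSum N m (λ k → h (suc k)) + S)
    ≡⟨ solve 3 (λ a b c → a :+ (b :+ c) := a :+ c :+ b) refl (1 * h 0) (binomSum N m (λ k → h (suc k))) S ⟩
      (binom m 0 * h 0 + S) + binomSum N m (λ k → h (suc k))
    ≡⟨ cong (_+ binomSum N m (λ k → h (suc k))) (sym (sumBelow-suc N (λ k → binom m k * h k))) ⟩
      binomSum (suc N) m h + binomSum N m (λ k → h (suc k))
    ∎
    where
    open ≡-Reasoning
    S = sumBelow N (λ k → binom m (suc k) * h (suc k))

  sumL : {A : Set} → List A → (A → ℕ) → ℕ
  sumL []       f = 0
  sumL (x ∷ xs) f = f x + sumL xs f

  sumL-++ : {A : Set} (xs ys : List A) (f : A → ℕ) → sumL (xs ++ ys) f ≡ sumL xs f + sumL ys f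
  sumL-++ []       ys f = refl
  sumL-++ (x ∷ xs) ys f = trans (cong (f x +_) (sumL-++ xs ys f)) (sym (+-assoc (f x) _ _))

  sumL-map : {A B : Set} (g : A → B) (xs : List A) (f : B → ℕ) → sumL (map g xs) f ≡ sumL xs (f ∘ g)
  sumL-map g []       f = refl
  sumL-map g (x ∷ xs) f = cong (f (g x) +_) (sumL-map g xs f)

  sumL-mono : {A : Set} (xs : List A) {f g : A → ℕ} → (∀ x → x ∈ xs → f x ≤ g x) → sumL xs f ≤ sumL xs g
  sumL-mono []       f≤g = z≤n
  sumL-mono (x ∷ xs) f≤g = +-mono-≤ (f≤g x (here refl)) (sumL-mono xs (λ y y∈xs → f≤g y (there y∈xs)))

  sumL-+ : {A : Set} (xs : List A) (f g : A → ℕ) → sumL xs (λ x → f x + g x) ≡ sumL xs f + sumL xs g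
  sumL-+ []       f g = refl
  sumL-+ (x ∷ xs) f g = trans (cong (f x + g x +_) (sumL-+ xs f g))
    (solve 4 (λ a b c d → a :+ b :+ (c :+ d) := a :+ c :+ (b :+ d)) refl (f x) (g x) (sumL xs f) (sumL xs g))

  sumL-const : {A : Set} (xs : List A) (k : ℕ) → sumL xs (λ _ → k) ≡ length xs * k
  sumL-const []       k = refl
  sumL-const (x ∷ xs) k = cong (k +_) (sumL-const xs k)

  sumL-*ˡ : {A : Set} (xs : List A) (k : ℕ) (f : A → ℕ) → sumL xs (λ x → k * f x) ≡ k * sumL xs f
  sumL-*ˡ []       k f = sym (*-zeroʳ k)
  sumL-*ˡ (x ∷ xs) k f = trans (cong (k * f x +_) (sumL-*ˡ xs k f)) (sym (*-distribˡ-+ k (f x) _))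

  sumL-swap : {A B : Set} (xs : List A) (ys : List B) (f : A → B → ℕ) →
    sumL xs (λ x → sumL ys (f x)) ≡ sumL ys (λ y → sumL xs (λ x → f x y))
  sumL-swap []       ys f = sym (trans (sumL-const ys 0) (*-zeroʳ (length ys)))
  sumL-swap (x ∷ xs) ys f =
    trans (cong (sumL ys (f x) +_) (sumL-swap xs ys f)) (sym (sumL-+ ys (f x) (λ y → sumL xs (λ x' → f x' y))))

  sumL-member : {A : Set} {xs : List A} {x : A} (f : A → ℕ) → x ∈ xs → f x ≤ sumL xs f
  sumL-member {xs = y ∷ ys} f (here refl)  = m≤m+n (f y) _
  sumL-member {xs = y ∷ ys} f (there x∈ys) = ≤-trans (sumL-member f x∈ys) (m≤n+m _ (f y))

  words : ℕ → List (List Bool)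
  words zero    = [] ∷ []
  words (suc m) = map (true ∷_) (words m) ++ map (false ∷_) (words m)

  words-length : ∀ m {y} → y ∈ words m → length y ≡ m
  words-length zero    (here refl) = refl
  words-length (suc m) y∈ with ∈-++⁻ (map (true ∷_) (words m)) y∈
  ... | inj₁ y∈₁ with ∈-map⁻ (true ∷_) y∈₁
  ...   | y' , y'∈ , refl = cong suc (words-length m y'∈)
  words-length (suc m) y∈ | inj₂ y∈₂ with ∈-map⁻ (false ∷_) y∈₂
  ...   | y' , y'∈ , refl = cong suc (words-length m y'∈)

  words-unique : ∀ m → Unique (words m)
  words-unique zero    = [] ∷ []
  words-unique (suc m) = Unique.++⁺ (Unique.map⁺ ∷-injective (words-unique m)) (Unique.map⁺ ∷-injective (words-unique m)) disjoint
    where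
    ∷-injective : ∀ {b : Bool} {x y : List Bool} → b ∷ x ≡ b ∷ y → x ≡ y
    ∷-injective refl = refl
    disjoint : ∀ {v} → v ∈ map (true ∷_) (words m) × v ∈ map (false ∷_) (words m) → ⊥
    disjoint (v∈₁ , v∈₂) with ∈-map⁻ (true ∷_) v∈₁ | ∈-map⁻ (false ∷_) v∈₂
    ... | _ , _ , refl | _ , _ , ()

  sumL-words : ∀ m (f : List Bool → ℕ) →
    sumL (words (suc m)) f ≡ sumL (words m) (λ y → f (true ∷ y)) + sumL (words m) (λ y → f (false ∷ y))
  sumL-words m f = trans (sumL-++ (map (true ∷_) (words m)) _ f) (cong₂ _+_ (sumL-map _ (words m) f) (sumL-map _ (words m) f))

  differ : Bool → Bool → ℕ
  differ true  true  = 0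
  differ false false = 0
  differ true  false = 1
  differ false true  = 1

  differ≤1 : ∀ x b → differ x b ≤ 1
  differ≤1 true  true  = z≤n
  differ≤1 false false = z≤n
  differ≤1 true  false = s≤s z≤n
  differ≤1 false true  = s≤s z≤n

  differ-sym : ∀ x b → differ x b ≡ differ b x
  differ-sym true  true  = refl
  differ-sym false false = refl
  differ-sym true  false = refl
  differ-sym false true  = refl

  -- changes b w counts the positions of w whose symbol differs from the previous
  -- one, the symbol before the first position being b; runs w is the number of runs.
  changes : Bool → List Bool → ℕ
  changes b []       = 0
  changes b (x ∷ xs) = differ x b + changes x xs

  runs : List Bool → ℕ
  runs []       = 0
  runs (x ∷ xs) = suc (changes x xs)

  changes≤runs : ∀ b w → changes b w ≤ runs w
  changes≤runs b []       = z≤n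
  changes≤runs b (x ∷ xs) = +-monoˡ-≤ (changes x xs) (differ≤1 x b)

  changes≤length : ∀ b w → changes b w ≤ length w
  changes≤length b []       = z≤n
  changes≤length b (x ∷ xs) = +-mono-≤ (differ≤1 x b) (changes≤length x xs)

  changes-shift : ∀ b x w → changes x w ≤ suc (changes b w)
  changes-shift b x []       = z≤n
  changes-shift b x (z ∷ zs) =
    ≤-trans (+-monoˡ-≤ (changes z zs) (differ≤1 z x)) (s≤s (m≤n+m (changes z zs) (differ z b)))

  Del-changes : ∀ {t c y} → Del t c y → ∀ b → changes b c ≤ changes b y + 2 * t
  Del-changes del-nil b = z≤n
  Del-changes {t} {x ∷ c} {x ∷ y} (del-keep d) b = begin
      differ x b + changes x c
    ≤⟨ +-monoʳ-≤ (differ x b) (Del-changes d x) ⟩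
      differ x b + (changes x y + 2 * t)
    ≡⟨ sym (+-assoc (differ x b) (changes x y) (2 * t)) ⟩
      differ x b + changes x y + 2 * t
    ∎
    where open ≤-Reasoning
  Del-changes {suc t} {x ∷ c} {y} (del-drop d) b = begin
      differ x b + changes x c
    ≤⟨ +-mono-≤ (differ≤1 x b) (Del-changes d x) ⟩
      1 + (changes x y + 2 * t)
    ≤⟨ +-monoʳ-≤ 1 (+-monoˡ-≤ (2 * t) (changes-shift b x y)) ⟩
      1 + (suc (changes b y) + 2 * t)
    ≡⟨ solve 2 (λ r t → con 1 :+ (con 1 :+ r :+ con 2 :* t) := r :+ con 2 :* (con 1 :+ t)) refl (changes b y) t ⟩
      changes b y + 2 * suc t
    ∎
    where open ≤-Reasoning

  Del-runs : ∀ {t c y} → Del t c y → runs c ≤ runs y + 2 * t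
  Del-runs {t} {[]}            d = z≤n
  Del-runs {t} {true ∷ c}  {y} d = ≤-trans (Del-changes d false) (+-monoˡ-≤ (2 * t) (changes≤runs false y))
  Del-runs {t} {false ∷ c} {y} d = ≤-trans (Del-changes d true) (+-monoˡ-≤ (2 * t) (changes≤runs true y))

  runs≤length : ∀ w → runs w ≤ length w
  runs≤length []       = z≤n
  runs≤length (x ∷ xs) = s≤s (changes≤length x xs)

  changes-distribution : ∀ m N b (h : ℕ → ℕ) → m < N → sumL (words m) (λ y → h (changes b y)) ≡ binomSum N m h
  changes-distribution zero (suc N) b h _ =
    sym (trans (sumBelow-suc N (λ k → binom 0 k * h k)) (trans (cong (1 * h 0 +_) (sumBelow-0 N)) (+-identityʳ (1 * h 0))))
  changes-distribution (suc m) (suc N) true h (s≤s m<N) = begin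
      sumL (words (suc m)) (λ y → h (changes true y))
    ≡⟨ sumL-words m (λ y → h (changes true y)) ⟩
      sumL (words m) (λ y → h (changes true y)) + sumL (words m) (λ y → h (suc (changes false y)))
    ≡⟨ cong₂ _+_ (changes-distribution m (suc N) true h (m<n⇒m<1+n m<N)) (changes-distribution m N false (h ∘ suc) m<N) ⟩
      binomSum (suc N) m h + binomSum N m (h ∘ suc)
    ≡⟨ sym (binomSum-pascal N m h) ⟩
      binomSum (suc N) (suc m) h
    ∎
    where open ≡-Reasoning
  changes-distribution (suc m) (suc N) false h (s≤s m<N) = begin
      sumL (words (suc m)) (λ y → h (changes false y))
    ≡⟨ sumL-words m (λ y → h (changes false y)) ⟩
      sumL (words m) (λ y → h (suc (changes true y))) + sumL (words m) (λ y → h (changes false y))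
    ≡⟨ cong₂ _+_ (changes-distribution m N true (h ∘ suc) m<N) (changes-distribution m (suc N) false h (m<n⇒m<1+n m<N)) ⟩
      binomSum N m (h ∘ suc) + binomSum (suc N) m h
    ≡⟨ +-comm (binomSum N m (h ∘ suc)) _ ⟩
      binomSum (suc N) m h + binomSum N m (h ∘ suc)
    ≡⟨ sym (binomSum-pascal N m h) ⟩
      binomSum (suc N) (suc m) h
    ∎
    where open ≡-Reasoning

  runs-distribution : ∀ m N (h : ℕ → ℕ) → m < N → sumL (words (suc m)) (h ∘ runs) ≡ 2 * binomSum N m (h ∘ suc)
  runs-distribution m N h m<N = begin
      sumL (words (suc m)) (h ∘ runs)
    ≡⟨ sumL-words m (h ∘ runs) ⟩
      sumL (words m) (λ y → h (suc (changes true y))) + sumL (words m) (λ y → h (suc (changes false y)))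
    ≡⟨ cong₂ _+_ (changes-distribution m N true (h ∘ suc) m<N) (changes-distribution m N false (h ∘ suc) m<N) ⟩
      X + X
    ≡⟨ cong (X +_) (sym (+-identityʳ X)) ⟩
      2 * X
    ∎
    where
    open ≡-Reasoning
    X = binomSum N m (h ∘ suc)

  binom-sum : ∀ m N → m < N → sumBelow N (binom m) ≡ 2 ^ m
  binom-sum m N m<N = begin
      sumBelow N (binom m)
    ≡⟨ sumBelow-cong N (λ k → sym (*-identityʳ (binom m k))) ⟩
      binomSum N m (λ _ → 1)
    ≡⟨ sym (changes-distribution m N true (λ _ → 1) m<N) ⟩
      sumL (words m) (λ _ → 1)
    ≡⟨ trans (sumL-const (words m) 1) (*-identityʳ _) ⟩
      length (words m)
    ≡⟨ length-words m ⟩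
      2 ^ m
    ∎
    where
    open ≡-Reasoning
    length-words : ∀ m → length (words m) ≡ 2 ^ m
    length-words zero    = refl
    length-words (suc m) = begin
        length (map (true ∷_) (words m) ++ map (false ∷_) (words m))
      ≡⟨ length-++ (map (true ∷_) (words m)) ⟩
        length (map (true ∷_) (words m)) + length (map (false ∷_) (words m))
      ≡⟨ cong₂ _+_ (length-map _ (words m)) (length-map _ (words m)) ⟩
        length (words m) + length (words m)
      ≡⟨ cong₂ _+_ (length-words m) (trans (length-words m) (sym (+-identityʳ (2 ^ m)))) ⟩
        2 ^ suc m
      ∎

  Del-length : ∀ {t c y} → Del t c y → length c ≡ t + length y
  Del-length del-nil = refl
  Del-length {t} {_ ∷ c} {_ ∷ y} (del-keep d) = trans (cong suc (Del-length d)) (sym (+-suc t (length y)))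
  Del-length (del-drop d) = cong suc (Del-length d)

  Del-++ : ∀ u {w t y} → Del t (u ++ w) y →
    ∃[ i ] ∃[ j ] ∃[ y₁ ] ∃[ y₂ ] (t ≡ i + j × y ≡ y₁ ++ y₂ × Del i u y₁ × Del j w y₂)
  Del-++ [] {w} {t} {y} d = 0 , t , [] , y , refl , refl , del-nil , d
  Del-++ (x ∷ u) (del-keep d) with Del-++ u d
  ... | i , j , y₁ , y₂ , refl , refl , d₁ , d₂ = i , j , x ∷ y₁ , y₂ , refl , refl , del-keep d₁ , d₂
  Del-++ (x ∷ u) (del-drop d) with Del-++ u d
  ... | i , j , y₁ , y₂ , refl , refl , d₁ , d₂ = suc i , j , y₁ , y₂ , refl , refl , del-drop d₁ , d₂

  Del-replicate : ∀ k b {i y} → Del i (replicate k b) y → y ≡ replicate (k ∸ i) b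
  Del-replicate zero    b del-nil = refl
  Del-replicate (suc k) b {i} {_ ∷ y} (del-keep d) =
    trans (cong (b ∷_) (Del-replicate k b d)) (cong (λ u → replicate u b) (sym (+-∸-assoc 1 i≤k)))
    where
    i≤k : i ≤ k
    i≤k = subst (i ≤_) (trans (sym (Del-length d)) (length-replicate k)) (m≤m+n i (length y))
  Del-replicate (suc k) b (del-drop d) = Del-replicate k b d

  expand : List (Bool × ℕ) → List Bool
  expand []             = []
  expand ((b , k) ∷ rs) = replicate k b ++ expand rs

  push : Bool → List (Bool × ℕ) → List (Bool × ℕ)
  push x     []                   = (x , 1) ∷ []
  push true  ((true  , k) ∷ rs) = (true , suc k) ∷ rs
  push false ((false , k) ∷ rs) = (false , suc k) ∷ rs
  push true  ((false , k) ∷ rs) = (true , 1) ∷ (false , k) ∷ rs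
  push false ((true  , k) ∷ rs) = (false , 1) ∷ (true , k) ∷ rs

  rle : List Bool → List (Bool × ℕ)
  rle []       = []
  rle (x ∷ xs) = push x (rle xs)

  expand-push : ∀ x rs → expand (push x rs) ≡ x ∷ expand rs
  expand-push x     []                   = refl
  expand-push true  ((true  , k) ∷ rs) = refl
  expand-push false ((false , k) ∷ rs) = refl
  expand-push true  ((false , k) ∷ rs) = refl
  expand-push false ((true  , k) ∷ rs) = refl

  expand-rle : ∀ xs → expand (rle xs) ≡ xs
  expand-rle []       = refl
  expand-rle (x ∷ xs) = trans (expand-push x (rle xs)) (cong (x ∷_) (expand-rle xs))

  rle-head : ∀ y ys → ∃[ k ] ∃[ rs ] rle (y ∷ ys) ≡ (y , k) ∷ rs
  rle-head y []       = 1 , [] , refl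
  rle-head y (z ∷ zs) with rle-head z zs
  ... | k , rs , eq rewrite eq = push-head y z
    where
    push-head : ∀ y z → ∃[ k' ] ∃[ rs' ] push y ((z , k) ∷ rs) ≡ (y , k') ∷ rs'
    push-head true  true  = _ , _ , refl
    push-head false false = _ , _ , refl
    push-head true  false = _ , _ , refl
    push-head false true  = _ , _ , refl

  length-push : ∀ x y k rs → length (push x ((y , k) ∷ rs)) ≡ differ x y + suc (length rs)
  length-push true  true  k rs = refl
  length-push false false k rs = refl
  length-push true  false k rs = refl
  length-push false true  k rs = refl

  length-rle : ∀ xs → length (rle xs) ≡ runs xs
  length-rle []           = refl
  length-rle (x ∷ [])     = refl
  length-rle (x ∷ y ∷ ys) with rle-head y ys | length-rle (y ∷ ys)
  ... | k , rs , eq | ih rewrite eq = begin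
      length (push x ((y , k) ∷ rs))
    ≡⟨ length-push x y k rs ⟩
      differ x y + suc (length rs)
    ≡⟨ cong (differ x y +_) ih ⟩
      differ x y + suc (changes y ys)
    ≡⟨ +-suc (differ x y) (changes y ys) ⟩
      suc (differ x y + changes y ys)
    ≡⟨ cong (λ u → suc (u + changes y ys)) (differ-sym x y) ⟩
      suc (differ y x + changes y ys)
    ∎
    where open ≡-Reasoning

  -- Candidates for the t-deletions of expand rs: spread the t deletions over the
  -- runs and shorten each run accordingly.  withFirstRun g b k t lets the first run
  -- (b, k) lose i ≤ t symbols and takes the remaining words from g (t - i).
  withFirstRun : (ℕ → List (List Bool)) → Bool → ℕ → ℕ → List (List Bool)
  withFirstRun g b k zero    = map (replicate k b ++_) (g zero)
  withFirstRun g b k (suc t) = map (replicate k b ++_) (g (suc t)) ++ withFirstRun g b (k ∸ 1) t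

  candidates : ℕ → List (Bool × ℕ) → List (List Bool)
  candidates t       ((b , k) ∷ rs) = withFirstRun (λ s → candidates s rs) b k t
  candidates zero    []             = [] ∷ []
  candidates (suc t) []             = []

  -- Stars and bars: with p runs there are C(p + t - 1, t) candidates.
  length-withFirstRun : ∀ g b k p → (∀ s → length (g s) ≡ binom (p + s ∸ 1) s) →
    ∀ t → length (withFirstRun g b k t) ≡ binom (p + t) t
  length-withFirstRun g b k p len-g zero = trans (length-map _ (g zero)) (len-g zero)
  length-withFirstRun g b k p len-g (suc t) = begin
      length (map (replicate k b ++_) (g (suc t)) ++ withFirstRun g b (k ∸ 1) t)
    ≡⟨ length-++ (map (replicate k b ++_) (g (suc t))) ⟩
      length (map (replicate k b ++_) (g (suc t))) + length (withFirstRun g b (k ∸ 1) t)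
    ≡⟨ cong₂ _+_ (trans (length-map _ (g (suc t))) (len-g (suc t))) (length-withFirstRun g b (k ∸ 1) p len-g t) ⟩
      binom (p + suc t ∸ 1) (suc t) + binom (p + t) t
    ≡⟨ cong (λ u → binom (u ∸ 1) (suc t) + binom (p + t) t) (+-suc p t) ⟩
      binom (p + t) (suc t) + binom (p + t) t
    ≡⟨ +-comm (binom (p + t) (suc t)) (binom (p + t) t) ⟩
      binom (suc (p + t)) (suc t)
    ≡⟨ cong (λ u → binom u (suc t)) (sym (+-suc p t)) ⟩
      binom (p + suc t) (suc t)
    ∎
    where open ≡-Reasoning

  length-candidates : ∀ t rs → length (candidates t rs) ≡ binom (length rs + t ∸ 1) t
  length-candidates t       ((b , k) ∷ rs) =
    length-withFirstRun (λ s → candidates s rs) b k (length rs) (λ s → length-candidates s rs) t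
  length-candidates zero    []             = refl
  length-candidates (suc t) []             = sym (binom-zero t (suc t) ≤-refl)

  withFirstRun-∈ : ∀ g b k i s {y} → y ∈ g s → replicate (k ∸ i) b ++ y ∈ withFirstRun g b k (i + s)
  withFirstRun-∈ g b k zero    zero    y∈ = ∈-map⁺ (replicate k b ++_) y∈
  withFirstRun-∈ g b k zero    (suc s) y∈ = ∈-++⁺ˡ (∈-map⁺ (replicate k b ++_) y∈)
  withFirstRun-∈ g b k (suc i) s {y} y∈ =
    ∈-++⁺ʳ (map (replicate k b ++_) (g (suc (i + s))))
      (subst (λ u → replicate u b ++ y ∈ withFirstRun g b (k ∸ 1) (i + s)) (∸-+-assoc k 1 i) (withFirstRun-∈ g b (k ∸ 1) i s y∈))

  candidates-complete : ∀ rs {t y} → Del t (expand rs) y → y ∈ candidates t rs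
  candidates-complete []             del-nil = here refl
  candidates-complete ((b , k) ∷ rs) d with Del-++ (replicate k b) d
  ... | i , j , y₁ , y₂ , refl , refl , d₁ , d₂ rewrite Del-replicate k b d₁ =
    withFirstRun-∈ (λ s → candidates s rs) b k i j (candidates-complete rs d₂)

  del? : ∀ t c y → Dec (Del t c y)
  del? zero    []      []      = yes del-nil
  del? zero    []      (_ ∷ _) = no λ ()
  del? (suc t) []      _       = no λ ()
  del? zero    (x ∷ c) []      = no λ ()
  del? (suc t) (x ∷ c) []      = map′ del-drop (λ { (del-drop d) → d }) (del? t c [])
  del? zero    (x ∷ c) (z ∷ y) =
    map′ (λ { (refl , d) → del-keep d }) (λ { (del-keep d) → refl , d }) ((x Bool.≟ z) ×-dec del? zero c y)
  del? (suc t) (x ∷ c) (z ∷ y) =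
    map′ [ (λ { (refl , d) → del-keep d }) , del-drop ]
         (λ { (del-keep d) → inj₁ (refl , d) ; (del-drop d) → inj₂ d })
         (((x Bool.≟ z) ×-dec del? (suc t) c y) ⊎-dec del? t c (z ∷ y))

  𝟙 : {A : Set} → Dec A → ℕ
  𝟙 (yes _) = 1
  𝟙 (no _)  = 0

  𝟙-yes : {A : Set} (a? : Dec A) → A → 𝟙 a? ≡ 1
  𝟙-yes (yes _) _ = refl
  𝟙-yes (no ¬a) a = ⊥-elim (¬a a)

  count-unique : ∀ {A : Set} {P : A → Set} (P? : Decidable P) {xs ys : List A} → Unique xs →
    (∀ {x} → x ∈ xs → P x → x ∈ ys) → sumL xs (𝟙 ∘ P?) ≤ length ys
  count-unique P? {[]}     _            _   = z≤n
  count-unique P? {x ∷ xs} (x∉xs ∷ xs!) sub with P? x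
  ... | no  _  = count-unique P? xs! (λ x'∈xs → sub (there x'∈xs))
  ... | yes px with ∈-∃++ (sub (here refl) px)
  ...   | ys₁ , ys₂ , refl = subst (suc (sumL xs (𝟙 ∘ P?)) ≤_) (sym length-middle)
            (s≤s (count-unique P? xs! (λ x'∈xs px' → remove ys₁ (sub (there x'∈xs) px') (λ x'≡x → All.lookup x∉xs x'∈xs (sym x'≡x)))))
    where
    remove : ∀ {v} zs₁ → v ∈ zs₁ ++ x ∷ ys₂ → v ≢ x → v ∈ zs₁ ++ ys₂
    remove []        (here refl) v≢x = ⊥-elim (v≢x refl)
    remove []        (there v∈)  v≢x = v∈
    remove (z ∷ zs₁) (here refl) v≢x = here refl
    remove (z ∷ zs₁) (there v∈)  v≢x = there (remove zs₁ v∈ v≢x)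
    length-middle : length (ys₁ ++ x ∷ ys₂) ≡ suc (length (ys₁ ++ ys₂))
    length-middle = trans (length-++ ys₁) (trans (+-suc (length ys₁) (length ys₂)) (cong suc (sym (length-++ ys₁))))

  deletion-count : ∀ t c {xs} → Unique xs → sumL xs (𝟙 ∘ del? t c) ≤ binom (runs c + t ∸ 1) t
  deletion-count t c {xs} xs! = begin
      sumL xs (𝟙 ∘ del? t c)
    ≤⟨ count-unique (del? t c) xs! (λ _ d → candidates-complete (rle c) (subst (λ w → Del t w _) (sym (expand-rle c)) d)) ⟩
      length (candidates t (rle c))
    ≡⟨ length-candidates t (rle c) ⟩
      binom (length (rle c) + t ∸ 1) t
    ≡⟨ cong (λ p → binom (p + t ∸ 1) t) (length-rle c) ⟩
      binom (runs c + t ∸ 1) t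
    ∎
    where open ≤-Reasoning

  weighted-count : ∀ {A : Set} {P : A → Set} (P? : Decidable P) (w : A → ℕ) (xs : List A) {N Z} → 0 < N →
    sumL xs (𝟙 ∘ P?) ≤ N → (∀ {x} → x ∈ xs → P x → N * w x ≤ Z) →
    sumL xs (λ x → 𝟙 (P? x) * w x) ≤ Z
  weighted-count P? w xs {N} {Z} 0<N count≤N capacity = *-cancelˡ-≤ N {{>-nonZero 0<N}} (begin
      N * sumL xs (λ x → 𝟙 (P? x) * w x)
    ≡⟨ sym (sumL-*ˡ xs N (λ x → 𝟙 (P? x) * w x)) ⟩
      sumL xs (λ x → N * (𝟙 (P? x) * w x))
    ≤⟨ sumL-mono xs entry ⟩
      sumL xs (λ x → Z * 𝟙 (P? x))
    ≡⟨ sumL-*ˡ xs Z (𝟙 ∘ P?) ⟩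
      Z * sumL xs (𝟙 ∘ P?)
    ≤⟨ *-monoʳ-≤ Z count≤N ⟩
      Z * N
    ≡⟨ *-comm Z N ⟩
      N * Z
    ∎)
    where
    open ≤-Reasoning
    entry : ∀ x → x ∈ xs → N * (𝟙 (P? x) * w x) ≤ Z * 𝟙 (P? x)
    entry x x∈xs with P? x
    ... | yes px = subst₂ _≤_ (cong (N *_) (sym (*-identityˡ (w x)))) (sym (*-identityʳ Z)) (capacity x∈xs px)
    ... | no  _  = ≤-reflexive (trans (*-zeroʳ N) (sym (*-zeroʳ Z)))

  cover-sum : ∀ {A B : Set} {R : A → B → Set} (R? : ∀ c → Decidable (R c)) (w : B → ℕ) (cs : List A) (xs : List B) →
    (∀ {x} → x ∈ xs → ∃ λ c → c ∈ cs × R c x) →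
    sumL xs w ≤ sumL cs (λ c → sumL xs (λ x → 𝟙 (R? c x) * w x))
  cover-sum R? w cs xs covered = begin
      sumL xs w
    ≤⟨ sumL-mono xs hit ⟩
      sumL xs (λ x → sumL cs (λ c → 𝟙 (R? c x) * w x))
    ≡⟨ sumL-swap xs cs (λ x c → 𝟙 (R? c x) * w x) ⟩
      sumL cs (λ c → sumL xs (λ x → 𝟙 (R? c x) * w x))
    ∎
    where
    open ≤-Reasoning
    hit : ∀ x → x ∈ xs → w x ≤ sumL cs (λ c → 𝟙 (R? c x) * w x)
    hit x x∈xs with covered x∈xs
    ... | c , c∈cs , rcx = subst (_≤ sumL cs (λ c → 𝟙 (R? c x) * w x))
            (trans (cong (_* w x) (𝟙-yes (R? c x) rcx)) (*-identityˡ (w x)))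
            (sumL-member (λ c → 𝟙 (R? c x) * w x) c∈cs)

  prodBelow : ℕ → (ℕ → ℕ) → ℕ
  prodBelow zero    f = 1
  prodBelow (suc M) f = f M * prodBelow M f

  prodBelow-pos : ∀ M (f : ℕ → ℕ) → (∀ r → 0 < f r) → 0 < prodBelow M f
  prodBelow-pos zero    f f>0 = z<s
  prodBelow-pos (suc M) f f>0 = *-mono-< {0} {f M} {0} (f>0 M) (prodBelow-pos M f f>0)

  prodBelow-cong : ∀ M {f g : ℕ → ℕ} → (∀ r → r < M → f r ≡ g r) → prodBelow M f ≡ prodBelow M g
  prodBelow-cong zero    f≡g = refl
  prodBelow-cong (suc M) f≡g = cong₂ _*_ (f≡g M ≤-refl) (prodBelow-cong M (λ r r<M → f≡g r (m<n⇒m<1+n r<M)))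

  cofactor : ℕ → (ℕ → ℕ) → ℕ → ℕ
  cofactor M f R = prodBelow M (λ r → if r ≡ᵇ R then 1 else f r)

  cofactor-spec : ∀ M (f : ℕ → ℕ) {R} → R < M → cofactor M f R * f R ≡ prodBelow M f
  cofactor-spec (suc M) f {R} R<1+M with M ≡ᵇ R in M≡ᵇR
  ... | true with ≡ᵇ⇒≡ M R (subst T (sym M≡ᵇR) tt)
  ...   | refl = trans (*-comm _ (f M)) (cong (f M *_) (trans (*-identityˡ _) (prodBelow-cong M below)))
    where
    below : ∀ r → r < M → (if r ≡ᵇ M then 1 else f r) ≡ f r
    below r r<M with r ≡ᵇ M in r≡ᵇM
    ... | true  = ⊥-elim (<-irrefl (≡ᵇ⇒≡ r M (subst T (sym r≡ᵇM) tt)) r<M)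
    ... | false = refl
  cofactor-spec (suc M) f {R} R<1+M | false =
    trans (*-assoc (f M) _ (f R)) (cong (f M *_) (cofactor-spec M f (≤∧≢⇒< (≤-pred R<1+M) R≢M)))
    where
    R≢M : R ≢ M
    R≢M R≡M = subst T M≡ᵇR (≡⇒≡ᵇ M R (sym R≡M))

  <ᵇ-false : ∀ {x y} → (x <ᵇ y) ≡ false → y ≤ x
  <ᵇ-false x<ᵇy≡false = ≮⇒≥ (λ x<y → subst T x<ᵇy≡false (<⇒<ᵇ x<y))

  middleSum : ℕ → ℕ → ℕ
  middleSum n L = sumBelow n (λ r → if r <ᵇ L then 0 else (n ∸ 1) C r)

  lowerTail+middleSum : ∀ n L → lowerTail (suc n) L + middleSum (suc n) L ≡ 2 ^ n
  lowerTail+middleSum n L = begin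
      lowerTail (suc n) L + middleSum (suc n) L
    ≡⟨ sym (sumBelow-+ (suc n) _ _) ⟩
      sumBelow (suc n) (λ r → (if r <ᵇ L then n C r else 0) + (if r <ᵇ L then 0 else n C r))
    ≡⟨ sumBelow-cong (suc n) (λ r → trans (recombine (r <ᵇ L) (n C r)) (sym (binom≡C n r))) ⟩
      sumBelow (suc n) (binom n)
    ≡⟨ binom-sum n (suc n) ≤-refl ⟩
      2 ^ n
    ∎
    where
    open ≡-Reasoning
    recombine : ∀ b x → (if b then x else 0) + (if b then 0 else x) ≡ x
    recombine true  x = +-identityʳ x
    recombine false x = refl

  -- The counting argument for a list `code` of words whose t-deletion balls cover 𝔹^m,
  -- where t = t' + 1 and m = o + 1 (codewords then have length n = t + m).
  module CoveringCode (t' o : ℕ) (code : List (List Bool))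
    (covers : ∀ y → length y ≡ suc o → ∃ λ c → c ∈ code × Del (suc t') c y) where

    t m : ℕ
    t = suc t'
    m = suc o

    -- κ R = C(R + 3t - 1, t) bounds the number of t-deletions of any word having a
    -- t-deletion with R runs: such a word has at most R + 2t runs.
    κ : ℕ → ℕ
    κ R = binom (R + 3 * t ∸ 1) t

    κ-pos : ∀ R → 0 < κ R
    κ-pos R = binom-pos _ t (subst (t ≤_) (sym index) (m≤n+m t (R + t' + t)))
      where
      index : R + 3 * t ∸ 1 ≡ R + t' + t + t
      index = cong (_∸ 1) (solve 2 (λ R t' → R :+ con 3 :* (con 1 :+ t') := con 1 :+ (R :+ t' :+ (con 1 :+ t') :+ (con 1 :+ t'))) refl R t')

    -- A common multiple Z of κ 0, …, κ m, and the weight Z / κ (runs y) of a word y.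
    Z : ℕ
    Z = prodBelow (suc m) κ

    weight : List Bool → ℕ
    weight y = cofactor (suc m) κ (runs y)

    deletion-weight : ∀ c → sumL (words m) (λ y → 𝟙 (del? t c y) * weight y) ≤ Z
    deletion-weight []      = ≤-trans (≤-reflexive (trans (sumL-const (words m) 0) (*-zeroʳ (length (words m))))) z≤n
    deletion-weight (x ∷ c) = weighted-count (del? t (x ∷ c)) weight (words m)
      (binom-pos (changes x c + t) t (m≤n+m t _)) (deletion-count t (x ∷ c) (words-unique m)) capacity
      where
      capacity : ∀ {y} → y ∈ words m → Del t (x ∷ c) y → binom (runs (x ∷ c) + t ∸ 1) t * weight y ≤ Z
      capacity {y} y∈ d = begin
          binom (runs (x ∷ c) + t ∸ 1) t * weight y
        ≤⟨ *-monoˡ-≤ (weight y) (binom-monoˡ t (∸-monoˡ-≤ 1 runs-bound)) ⟩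
          κ (runs y) * weight y
        ≡⟨ *-comm (κ (runs y)) (weight y) ⟩
          weight y * κ (runs y)
        ≡⟨ cofactor-spec (suc m) κ (s≤s (≤-trans (runs≤length y) (≤-reflexive (words-length m y∈)))) ⟩
          Z
        ∎
        where
        open ≤-Reasoning
        runs-bound : runs (x ∷ c) + t ≤ runs y + 3 * t
        runs-bound = ≤-trans (+-monoˡ-≤ t (Del-runs d))
          (≤-reflexive (solve 2 (λ r t → r :+ con 2 :* t :+ t := r :+ con 3 :* t) refl (runs y) t))

    -- Double counting over the cover, then grouping the words by their number of
    -- runs (k + 1 runs occur 2 C(o, k) times): 2 Σ_k C(o, k) Z / κ (k+1) ≤ #code · Z.
    run-weights : 2 * binomSum m o (λ k → cofactor (suc m) κ (suc k)) ≤ length code * Z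
    run-weights = begin
        2 * binomSum m o (λ k → cofactor (suc m) κ (suc k))
      ≡⟨ sym (runs-distribution o m (cofactor (suc m) κ) ≤-refl) ⟩
        sumL (words m) weight
      ≤⟨ cover-sum (del? t) weight code (words m) (λ {y} y∈ → covers y (words-length m y∈)) ⟩
        sumL code (λ c → sumL (words m) (λ y → 𝟙 (del? t c y) * weight y))
      ≤⟨ sumL-mono code (λ c _ → deletion-weight c) ⟩
        sumL code (λ _ → Z)
      ≡⟨ sumL-const code Z ⟩
        length code * Z
      ∎
      where open ≤-Reasoning

    middle : ℕ → ℕ → ℕ
    middle L r = if r <ᵇ L then 0 else binom (t + o) r

    -- Term-wise comparison, for r = t + k ≥ L: by trinomial revision
    -- C(t+o, t+k) C(t+k, t) = C(t+o, t) C(o, k), and κ (k+1) = C(t+k+2t, t).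
    middle-term : ∀ L p q → (∀ r → L ≤ r → p * binom (r + 2 * t) t ≤ q * binom r t) → ∀ k →
      p * Z * middle L (t + k) ≤ (binom (t + o) t * q) * (binom o k * cofactor (suc m) κ (suc k))
    middle-term L p q ratio k with t + k <ᵇ L in below
    ... | true  = ≤-trans (≤-reflexive (*-zeroʳ (p * Z))) z≤n
    ... | false with k ≤? o
    ...   | no  k≰o = ≤-trans (≤-reflexive (trans (cong (p * Z *_) (binom-zero (t + o) (t + k) (+-monoʳ-< t (≰⇒> k≰o)))) (*-zeroʳ (p * Z)))) z≤n
    ...   | yes k≤o = begin
        p * Z * B
      ≡⟨ cong (λ u → p * u * B) (sym (cofactor-spec (suc m) κ (s≤s (s≤s k≤o)))) ⟩
        p * (w * κ (suc k)) * B
      ≡⟨ cong (λ i → p * (w * binom i t) * B) κ-index ⟩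
        p * (w * binom (r + 2 * t) t) * B
      ≡⟨ solve 4 (λ p w c b → p :* (w :* c) :* b := w :* b :* (p :* c)) refl p w (binom (r + 2 * t) t) B ⟩
        w * B * (p * binom (r + 2 * t) t)
      ≤⟨ *-monoʳ-≤ (w * B) (ratio r (<ᵇ-false below)) ⟩
        w * B * (q * binom r t)
      ≡⟨ solve 4 (λ w b q c → w :* b :* (q :* c) := w :* q :* (b :* c)) refl w B q (binom r t) ⟩
        w * q * (B * binom r t)
      ≡⟨ cong (w * q *_) (trinomial-revision t o k) ⟩
        w * q * (binom (t + o) t * binom o k)
      ≡⟨ solve 4 (λ w q a b → w :* q :* (a :* b) := a :* q :* (b :* w)) refl w q (binom (t + o) t) (binom o k) ⟩
        (binom (t + o) t * q) * (binom o k * w)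
      ∎
      where
      open ≤-Reasoning
      r = t + k
      B = binom (t + o) (t + k)
      w = cofactor (suc m) κ (suc k)
      κ-index : suc k + 3 * t ∸ 1 ≡ t + k + 2 * t
      κ-index = solve 2 (λ k t → k :+ con 3 :* t := t :+ k :+ con 2 :* t) refl k t

    -- The middle sum reindexed by r = t + k; the terms r < t ≤ L vanish.
    middle-reindex : ∀ L → t ≤ L → middleSum (suc (t + o)) L ≡ sumBelow m (λ k → middle L (t + k))
    middle-reindex L t≤L = begin
        middleSum (suc (t + o)) L
      ≡⟨ sumBelow-cong (suc (t + o)) (λ r → cong (λ x → if r <ᵇ L then 0 else x) (sym (binom≡C (t + o) r))) ⟩
        sumBelow (suc (t + o)) (middle L)
      ≡⟨ cong (λ N → sumBelow N (middle L)) (sym (+-suc t o)) ⟩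
        sumBelow (t + m) (middle L)
      ≡⟨ sumBelow-drop t m (middle L) vanish ⟩
        sumBelow m (λ k → middle L (t + k))
      ∎
      where
      open ≡-Reasoning
      vanish : ∀ r → r < t → middle L r ≡ 0
      vanish r r<t with r <ᵇ L in r<ᵇL
      ... | true  = refl
      ... | false = ⊥-elim (<⇒≱ (≤-trans r<t t≤L) (<ᵇ-false r<ᵇL))

    covering-bound : ∀ L p q → t ≤ L → (∀ r → L ≤ r → p * ((r + 2 * t) C t) ≤ q * (r C t)) →
      2 * p * middleSum (suc (t + o)) L ≤ length code * (((t + o) C t) * q)
    covering-bound L p q t≤L ratioC = *-cancelʳ-≤ _ _ Z {{>-nonZero (prodBelow-pos (suc m) κ κ-pos)}} (begin
        2 * p * middleSum (suc (t + o)) L * Z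
      ≡⟨ cong (λ s → 2 * p * s * Z) (middle-reindex L t≤L) ⟩
        2 * p * S * Z
      ≡⟨ solve 3 (λ p s z → con 2 :* p :* s :* z := con 2 :* (p :* z :* s)) refl p S Z ⟩
        2 * (p * Z * S)
      ≡⟨ cong (2 *_) (sym (sumBelow-*ˡ m (p * Z) (λ k → middle L (t + k)))) ⟩
        2 * sumBelow m (λ k → p * Z * middle L (t + k))
      ≤⟨ *-monoʳ-≤ 2 (sumBelow-mono m (middle-term L p q ratio)) ⟩
        2 * sumBelow m (λ k → Qq * (binom o k * w k))
      ≡⟨ cong (2 *_) (sumBelow-*ˡ m Qq (λ k → binom o k * w k)) ⟩
        2 * (Qq * binomSum m o w)
      ≡⟨ solve 2 (λ a b → con 2 :* (a :* b) := a :* (con 2 :* b)) refl Qq (binomSum m o w) ⟩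
        Qq * (2 * binomSum m o w)
      ≤⟨ *-monoʳ-≤ Qq run-weights ⟩
        Qq * (length code * Z)
      ≡⟨ solve 3 (λ a c z → a :* (c :* z) := c :* a :* z) refl Qq (length code) Z ⟩
        length code * Qq * Z
      ≡⟨ cong (λ x → length code * (x * q) * Z) (binom≡C (t + o) t) ⟩
        length code * (((t + o) C t) * q) * Z
      ∎)
      where
      open ≤-Reasoning
      S = sumBelow m (λ k → middle L (t + k))
      Qq = binom (t + o) t * q
      w : ℕ → ℕ
      w k = cofactor (suc m) κ (suc k)
      ratio : ∀ r → L ≤ r → p * binom (r + 2 * t) t ≤ q * binom r t
      ratio r L≤r = subst₂ (λ x y → p * x ≤ q * y) (sym (binom≡C (r + 2 * t) t)) (sym (binom≡C r t)) (ratioC r L≤r)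

module Fractions where

  open import Defs using (frac)
  open import Data.Nat as ℕ using (ℕ; suc; z≤n)
  open import Data.Nat.Solver using (module +-*-Solver)
  open import Data.Integer as ℤ using (+_)
  import Data.Integer.Properties as ℤₚ
  open import Data.Rational using (0ℚ; _≤_; _+_; _*_; toℚᵘ)
  import Data.Rational.Properties as ℚₚ
  open import Data.Rational.Unnormalised as ℚᵘ using (mkℚᵘ)
  import Data.Rational.Unnormalised.Properties as ℚᵘₚ
  open import Relation.Binary.PropositionalEquality
  open +-*-Solver

  frac≃ : ∀ x d → toℚᵘ (frac x (suc d)) ℚᵘ.≃ mkℚᵘ (+ x) d
  frac≃ x d = ℚₚ.toℚᵘ-fromℚᵘ (mkℚᵘ (+ x) d)

  frac-≤ : ∀ x y {d e} → x ℕ.* suc e ℕ.≤ y ℕ.* suc d → frac x (suc d) ≤ frac y (suc e)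
  frac-≤ x y {d} {e} cross = ℚₚ.toℚᵘ-cancel-≤
    (ℚᵘₚ.≤-respʳ-≃ (ℚᵘₚ.≃-sym (frac≃ y e)) (ℚᵘₚ.≤-respˡ-≃ (ℚᵘₚ.≃-sym (frac≃ x d))
      (ℚᵘ.*≤* (subst₂ ℤ._≤_ (ℤₚ.pos-* x (suc e)) (ℤₚ.pos-* y (suc d)) (ℤ.+≤+ cross)))))

  frac-* : ∀ x y {d e} → frac x (suc d) * frac y (suc e) ≡ frac (x ℕ.* y) (suc d ℕ.* suc e)
  frac-* x y {d} {e} = ℚₚ.toℚᵘ-injective (ℚᵘₚ.≃-trans (ℚₚ.toℚᵘ-homo-* (frac x (suc d)) (frac y (suc e)))
    (ℚᵘₚ.≃-trans (ℚᵘₚ.*-cong (frac≃ x d) (frac≃ y e))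
    (ℚᵘₚ.≃-trans (ℚᵘ.*≡* (cong (ℤ._* (+ suc (e ℕ.+ d ℕ.* suc e))) (sym (ℤₚ.pos-* x y))))
      (ℚᵘₚ.≃-sym (frac≃ (x ℕ.* y) (e ℕ.+ d ℕ.* suc e))))))

  frac-+ : ∀ x y {d} → frac x (suc d) + frac y (suc d) ≡ frac (x ℕ.+ y) (suc d)
  frac-+ x y {d} = ℚₚ.toℚᵘ-injective (ℚᵘₚ.≃-trans (ℚₚ.toℚᵘ-homo-+ (frac x (suc d)) (frac y (suc d)))
    (ℚᵘₚ.≃-trans (ℚᵘₚ.+-cong (frac≃ x d) (frac≃ y d))
    (ℚᵘₚ.≃-trans (ℚᵘ.*≡* cross) (ℚᵘₚ.≃-sym (frac≃ (x ℕ.+ y) d)))))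
    where
    s = suc d
    cross : (+ x ℤ.* + s ℤ.+ + y ℤ.* + s) ℤ.* + s ≡ + (x ℕ.+ y) ℤ.* + (s ℕ.* s)
    cross = begin
        (+ x ℤ.* + s ℤ.+ + y ℤ.* + s) ℤ.* + s
      ≡⟨ cong (ℤ._* + s) (sym (cong₂ ℤ._+_ (ℤₚ.pos-* x s) (ℤₚ.pos-* y s))) ⟩
        + (x ℕ.* s ℕ.+ y ℕ.* s) ℤ.* + s
      ≡⟨ sym (ℤₚ.pos-* (x ℕ.* s ℕ.+ y ℕ.* s) s) ⟩
        + ((x ℕ.* s ℕ.+ y ℕ.* s) ℕ.* s)
      ≡⟨ cong +_ (solve 3 (λ x y s → (x :* s :+ y :* s) :* s := (x :+ y) :* (s :* s)) refl x y s) ⟩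
        + ((x ℕ.+ y) ℕ.* (s ℕ.* s))
      ≡⟨ ℤₚ.pos-* (x ℕ.+ y) (s ℕ.* s) ⟩
        + (x ℕ.+ y) ℤ.* + (s ℕ.* s)
      ∎
      where open ≡-Reasoning

  -- Fractions of naturals are nonnegative (frac x 0 is 0 by convention).
  frac-nonneg : ∀ x d → 0ℚ ≤ frac x d
  frac-nonneg x ℕ.zero    = ℚₚ.≤-refl
  frac-nonneg x (suc d) = frac-≤ 0 x {0} {d} z≤n

module BoundShape where

  open import Defs using (frac)
  open import Data.Nat as ℕ using (suc)
  import Data.Nat.Properties as ℕₚ
  open import Data.Nat.Solver using (module +-*-Solver)
  open import Data.Rational using (0ℚ; 1ℚ; _≤_; _+_; _*_; _-_; -_; nonNegative)
  import Data.Rational.Properties as ℚₚ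
  import Data.Rational.Solver as ℚ-Solver
  open import Relation.Binary.PropositionalEquality
  open Fractions
  open +-*-Solver

  complement-≤ : ∀ P lo up mid → 0 ℕ.< P → P ℕ.≤ lo ℕ.+ up ℕ.+ mid →
    1ℚ - frac lo P - frac up P ≤ frac mid P
  complement-≤ (suc P) lo up mid _ P≤ = ℚₚ.≤-trans
    (ℚₚ.+-monoˡ-≤ (- frac up (suc P)) (ℚₚ.+-monoˡ-≤ (- frac lo (suc P)) 1≤))
    (ℚₚ.≤-reflexive (solveℚ 3 (λ z x y → z ⊕ x ⊕ y ⊖ x ⊖ y ≐ z) refl (frac mid (suc P)) (frac lo (suc P)) (frac up (suc P))))
    where
    open ℚ-Solver.+-*-Solver using () renaming (solve to solveℚ; _:+_ to _⊕_; _:-_ to _⊖_; _:=_ to _≐_)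
    1≤ : 1ℚ ≤ frac mid (suc P) + frac lo (suc P) + frac up (suc P)
    1≤ = subst (1ℚ ≤_) (sym (trans (cong (_+ frac up (suc P)) (frac-+ mid lo)) (frac-+ (mid ℕ.+ lo) up)))
      (frac-≤ 1 (mid ℕ.+ lo ℕ.+ up) (ℕₚ.≤-trans (ℕₚ.≤-reflexive (ℕₚ.*-identityˡ (suc P)))
        (ℕₚ.≤-trans P≤′ (ℕₚ.≤-reflexive (sym (ℕₚ.*-identityʳ _))))))
      where
      P≤′ : suc P ℕ.≤ mid ℕ.+ lo ℕ.+ up
      P≤′ = ℕₚ.≤-trans P≤ (ℕₚ.≤-reflexive (trans (ℕₚ.+-comm (lo ℕ.+ up) mid) (sym (ℕₚ.+-assoc mid lo up))))

  bound-shape : ∀ P q a d c e lo up mid cc → 0 ℕ.< P → 0 ℕ.< q → 0 ℕ.< d → 0 ℕ.< e →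
    P ℕ.≤ lo ℕ.+ up ℕ.+ mid → 2 ℕ.* (a ℕ.* c) ℕ.* mid ℕ.≤ cc ℕ.* (q ℕ.* (d ℕ.* e)) →
    frac (2 ℕ.* P) q * frac a d * frac c e * (1ℚ - frac lo P - frac up P) ≤ frac cc 1
  bound-shape P@(suc _) (suc q) a (suc d) c (suc e) lo up mid cc 0<P _ _ _ P≤ counted = begin
      K * (1ℚ - frac lo P - frac up P)
    ≤⟨ ℚₚ.*-monoˡ-≤-nonNeg K {{nonNegative K≥0}} (complement-≤ P lo up mid 0<P P≤) ⟩
      K * frac mid P
    ≡⟨ cong (_* frac mid P) K≡ ⟩
      frac (2 ℕ.* P ℕ.* a ℕ.* c) (suc q ℕ.* suc d ℕ.* suc e) * frac mid P
    ≡⟨ frac-* (2 ℕ.* P ℕ.* a ℕ.* c) mid ⟩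
      frac (2 ℕ.* P ℕ.* a ℕ.* c ℕ.* mid) (suc q ℕ.* suc d ℕ.* suc e ℕ.* P)
    ≤⟨ frac-≤ (2 ℕ.* P ℕ.* a ℕ.* c ℕ.* mid) cc {_} {0} cross ⟩
      frac cc 1
    ∎
    where
    open ℚₚ.≤-Reasoning
    K = frac (2 ℕ.* P) (suc q) * frac a (suc d) * frac c (suc e)
    K≡ : K ≡ frac (2 ℕ.* P ℕ.* a ℕ.* c) (suc q ℕ.* suc d ℕ.* suc e)
    K≡ = trans (cong (_* frac c (suc e)) (frac-* (2 ℕ.* P) a)) (frac-* (2 ℕ.* P ℕ.* a) c)
    K≥0 : 0ℚ ≤ K
    K≥0 = subst (0ℚ ≤_) (sym K≡) (frac-nonneg (2 ℕ.* P ℕ.* a ℕ.* c) (suc q ℕ.* suc d ℕ.* suc e))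
    cross : 2 ℕ.* P ℕ.* a ℕ.* c ℕ.* mid ℕ.* 1 ℕ.≤ cc ℕ.* (suc q ℕ.* suc d ℕ.* suc e ℕ.* P)
    cross = ℕₚ.≤-trans (ℕₚ.≤-reflexive (solve 5 (λ P a c m t → t :* P :* a :* c :* m :* con 1 := t :* (a :* c) :* m :* P) refl P a c mid 2))
      (ℕₚ.≤-trans (ℕₚ.*-monoˡ-≤ P counted)
        (ℕₚ.≤-reflexive (solve 5 (λ P cc q d e → cc :* (q :* (d :* e)) :* P := cc :* (q :* d :* e :* P)) refl P cc (suc q) (suc d) (suc e))))

open import Defs
open import Data.Bool using (Bool)
open import Data.Nat using (ℕ; suc; _+_; _*_; _∸_; _^_; _>_; _≥_; s≤s; z≤n)
import Data.Nat as ℕ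
open import Data.Nat.Properties using (m≤n⇒∃[o]m+o≡n; m+n∸m≡n; +-suc; +-monoˡ-≤; m≤m+n; m≤n+m; ≤-trans; m^n>0)
open import Data.Nat.Combinatorics using (_C_)
open import Data.List using (List; length)
open import Data.List.Relation.Unary.Unique.Propositional using (Unique)
open import Data.Rational using (_≤_)
open import Data.List.Membership.Propositional using (_∈_)
open import Data.Product using (_,_; _×_; ∃)
open import Relation.Binary.PropositionalEquality using (_≡_; refl; trans; sym; cong; subst)
open Combinatorics using (C-pos; window; window-denominator-pos; middleSum; lowerTail+middleSum; module CoveringCode)
open BoundShape using (bound-shape)

-- With t = t' + 1 and n = t + o + 1: the tails make up 2^(n-1) together with the
-- middle sum, the covering bound estimates the middle sum with the constant supplied
-- by `window`, and bound-shape assembles the two into the rational inequality.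
theorem2 : (t n : ℕ) → t ≥ 1 → n > t → (C : List (List Bool)) → Unique C →
    IsPerfectDeletionCode t n C →
    bound t n ≤ frac (length C) 1
theorem2 t@(suc t') n (s≤s z≤n) n>t code _ (_ , perfect) with m≤n⇒∃[o]m+o≡n n>t
... | o , refl =
  bound-shape (2 ^ (t + o)) Q (a + 1) (a + 1 + 2 * t) c₁ c₂ (lowerTail n L) (upperTail n U) (middleSum n L) (length code)
    (m^n>0 2 (t + o)) (C-pos (m≤m+n t o)) (≤-trans (m≤n+m 1 a) (m≤m+n (a + 1) (2 * t))) (window-denominator-pos a b t')
    tails counted
  where
  a b L U Q c₁ c₂ : ℕ
  a = floorCbrt n
  b = floorCbrtSq n
  L = a ∸ 1 + b + t
  U = n ∸ 1 ∸ b + t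
  Q = (t + o) C t
  c₁ = (b + t ∸ 1) C t
  c₂ = (b + a + 3 * t ∸ 1) C t
  tails : 2 ^ (t + o) ℕ.≤ lowerTail n L + upperTail n U + middleSum n L
  tails = subst (ℕ._≤ lowerTail n L + upperTail n U + middleSum n L) (lowerTail+middleSum (t + o) L)
            (+-monoˡ-≤ (middleSum n L) (m≤m+n (lowerTail n L) (upperTail n U)))
  covers : ∀ y → length y ≡ suc o → ∃ λ c → c ∈ code × Del t c y
  covers y length≡ = perfect y (trans length≡ (sym (trans (cong (_∸ t) (sym (+-suc t o))) (m+n∸m≡n t (suc o)))))
  counted : 2 * ((a + 1) * c₁) * middleSum n L ℕ.≤ length code * (Q * ((a + 1 + 2 * t) * c₂))
  counted = CoveringCode.covering-bound t' o code covers L ((a + 1) * c₁) ((a + 1 + 2 * t) * c₂)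
    (m≤n+m t (a ∸ 1 + b)) (window a b t')
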